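{- Let $G_1=(V,E_1)$, $G_2=(V,E_2)$, $G_3=(V,E_3)$ be three simple graphs on the same finite vertex set $V$ with $|V|=m$. Let $\delta_1$ be the minimum degree of $G_1$ and let $\Delta_2,\Delta_3$ be the maximum degrees of $G_2,G_3$ respectively. Let $\ell\geq 2$ be an integer, and assume \[ m\left(\frac{3\ell-1}{3\ell}\right)\leq \delta_1\quad\text{and}\quad \Delta_2\Delta_3\leq \frac{m-3}{15\ell^2}. \] Then there are $\lfloor m/\ell\rfloor$ pairwise vertex-disjoint copies of $K_\ell$ in $G_1$ such that no two of them form an alternating-$(\ell,2,\ell,2)$-bag with $G_2$ and $G_3$.
   Context: Two vertex-disjoint copies $A_1,A_2$ of the complete graph $K_\ell$ in $G_1$ form an alternating-$(\ell,2,\ell,2)$-bag with $G_2$ and $G_3$ if there exist two vertex-disjoint edges $e_2\in E_2$ and $e_3\in E_3$ such that each of $e_2,e_3$ joins a vertex of $A_1$ to a vertex of $A_2$. -}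

module Defs where

open import Data.Nat using (ℕ; _⊓_; _⊔_)
open import Data.Bool using (Bool; true; false; T)
open import Data.Bool.Properties using (T?)
open import Data.Fin using (Fin)
open import Data.List using (List; map; foldr; filter; length; allFin)
open import Data.Product using (Σ; ∃; _×_; _,_)
open import Relation.Binary.PropositionalEquality using (_≡_; _≢_)

record SimpleGraph (m : ℕ) : Set where
  field
    adj    : Fin m → Fin m → Bool
    sym    : ∀ u v → adj u v ≡ adj v u
    irrefl : ∀ v → adj v v ≡ false

open SimpleGraph public

Edge : ∀ {m} → SimpleGraph m → Fin m → Fin m → Set
Edge G u v = adj G u v ≡ true

degree : ∀ {m} → SimpleGraph m → Fin m → ℕ
degree {m} G v = length (filter (λ u → T? (adj G v u)) (allFin m))

maxDegree : ∀ {m} → SimpleGraph m → ℕ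
maxDegree {m} G = foldr _⊔_ 0 (map (degree G) (allFin m))

-- minimum degree; the initial value m exceeds every degree (which is ≤ m-1),
-- so for m ≥ 1 this is exactly the minimum degree (for m = 0 it is 0).
minDegree : ∀ {m} → SimpleGraph m → ℕ
minDegree {m} G = foldr _⊓_ m (map (degree G) (allFin m))

-- A is a copy of K_ℓ in G: ℓ distinct vertices, pairwise adjacent.
-- (Distinctness of the vertices is imposed separately via injectivity.)
IsClique : ∀ {m ℓ} → SimpleGraph m → (Fin ℓ → Fin m) → Set
IsClique G A = ∀ a b → a ≢ b → Edge G (A a) (A b)

-- A1, A2 form an alternating-(ℓ,2,ℓ,2)-bag with G2 and G3: there are
-- vertex-disjoint edges e2 = {A1 a, A2 b} ∈ E2 and e3 = {A1 c, A2 d} ∈ E3,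
-- each joining a vertex of A1 to a vertex of A2.
AltBag : ∀ {m ℓ} → SimpleGraph m → SimpleGraph m →
         (Fin ℓ → Fin m) → (Fin ℓ → Fin m) → Set
AltBag G₂ G₃ A₁ A₂ =
  ∃ λ a → ∃ λ b → ∃ λ c → ∃ λ d →
    Edge G₂ (A₁ a) (A₂ b) × Edge G₃ (A₁ c) (A₂ d) ×
    A₁ a ≢ A₁ c × A₁ a ≢ A₂ d × A₂ b ≢ A₁ c × A₂ b ≢ A₂ d

{-# OPTIONS --safe #-}
-- Start from any ⌊m/ℓ⌋ pairwise disjoint ℓ-sets of vertices (blocks) and remove defects one at a
-- time: swap a vertex x of a defective block with a vertex y outside a forbidden set. The forbidden
-- set is a union of neighbourhoods and blocks, so its size is bounded by ℓ, the number m − δ₁ of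
-- non-neighbours in G₁ and Δ₂, Δ₃; the degree hypotheses make it smaller than m, so y exists, and
-- avoiding it guarantees that the swap repairs the defect without creating new ones, so the number
-- of defects drops.
-- First every block is made a clique of H = G₁ ∖ G₂ ∖ G₃, then alternating bags are removed while
-- the cliques are kept. Because blocks are H-cliques, no G₂- or G₃-edge joins two vertices of a
-- block, nor x and y; the remaining bags through x or y are excluded by the forbidden set.
-- If G₂ or G₃ has no edges there are no bags at all, and cliques of G₁ suffice.
module Submission where

open import Defs renaming (sym to adj-sym)
open import Data.Bool using (true; false; not; _∧_)
open import Data.Bool.Properties using (T?; T-≡) renaming (_≟_ to _≟ᵇ_)
open import Data.Empty using (⊥; ⊥-elim)
open import Data.Fin using (Fin; punchIn; combine; inject≤) renaming (zero to fzero)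
open import Data.Fin.Permutation.Components using (transpose; transpose-inverse)
import Data.Fin.Properties as Fin
open import Data.List
  using (List; []; _∷_; _++_; length; filter; allFin; tabulate; concatMap; cartesianProduct; foldr; map; lookup)
open import Data.List.Membership.Propositional using (_∈_; _∉_; lose)
open import Data.List.Membership.Propositional.Properties
  using (∈-++⁺ˡ; ∈-++⁺ʳ; ∈-concatMap⁺; ∈-filter⁺; ∈-allFin; ∈-tabulate⁺; ∈-cartesianProduct⁺;
         ∈-length)
open import Data.List.Properties using (length-++; length-tabulate)
open import Data.List.Relation.Unary.Any using (here; there; index; any?; satisfied)
open import Data.List.Relation.Unary.Any.Properties using (lookup-index)
open import Data.Nat using (ℕ; zero; suc; _+_; _*_; _∸_; _≤_; _<_; _/_; NonZero; z≤n; s≤s; _⊔_; _⊓_)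
open import Data.Nat.DivMod using (m/n*n≤m)
open import Data.Nat.Induction using (<-wellFounded)
open import Data.Nat.Properties
open import Data.Nat.Tactic.RingSolver using (solve-∀)
open import Data.Product using (Σ; ∃; _×_; _,_; proj₁; proj₂; uncurry)
open import Data.Sum using (_⊎_; inj₁; inj₂)
open import Function using (_∘_)
open import Function.Bundles using (Equivalence)
open import Induction.WellFounded using (Acc; acc)
open import Relation.Binary.PropositionalEquality
  using (_≡_; _≢_; refl; trans; cong; cong₂; subst; subst₂; ≢-sym; module ≡-Reasoning)
  renaming (sym to ≡-sym)
open import Relation.Nullary using (¬_; Dec; yes; no; ¬?; contradiction)
open import Relation.Nullary.Decidable using (_×-dec_; _⊎-dec_; dec-true; dec-false; decidable-stable)
open import Relation.Unary using (Decidable; _⊆_)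
open import Relation.Unary.Properties using (∁?)

module _ {A : Set} {P Q : A → Set} (P? : Decidable P) (Q? : Decidable Q) (P⊆Q : P ⊆ Q) where

  length-filter-mono : ∀ xs → length (filter P? xs) ≤ length (filter Q? xs)
  length-filter-mono [] = z≤n
  length-filter-mono (x ∷ xs) with P? x | Q? x
  ... | yes _ | yes _ = s≤s (length-filter-mono xs)
  ... | yes p | no ¬q = contradiction (P⊆Q p) ¬q
  ... | no _  | yes _ = m≤n⇒m≤1+n (length-filter-mono xs)
  ... | no _  | no _  = length-filter-mono xs

  length-filter-mono-< : ∀ {x} xs → x ∈ xs → Q x → ¬ P x →
                         length (filter P? xs) < length (filter Q? xs)
  length-filter-mono-< (x ∷ xs) (here refl) q ¬p with P? x | Q? x
  ... | yes p | _     = contradiction p ¬p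
  ... | no _  | yes _ = s≤s (length-filter-mono xs)
  ... | no _  | no ¬q = contradiction q ¬q
  length-filter-mono-< (y ∷ xs) (there x∈xs) q ¬p with P? y | Q? y
  ... | yes _ | yes _ = s≤s (length-filter-mono-< xs x∈xs q ¬p)
  ... | yes p | no ¬q = contradiction (P⊆Q p) ¬q
  ... | no _  | yes _ = m<n⇒m<1+n (length-filter-mono-< xs x∈xs q ¬p)
  ... | no _  | no _  = length-filter-mono-< xs x∈xs q ¬p

length-filter-∁ : ∀ {A : Set} {P : A → Set} (P? : Decidable P) xs →
                  length (filter P? xs) + length (filter (∁? P?) xs) ≡ length xs
length-filter-∁ P? [] = refl
length-filter-∁ P? (x ∷ xs) with P? x
... | yes _ = cong suc (length-filter-∁ P? xs)
... | no _  = trans (+-suc _ _) (cong suc (length-filter-∁ P? xs))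

length-++-≤ : ∀ {A : Set} (xs : List A) {ys a b} →
              length xs ≤ a → length ys ≤ b → length (xs ++ ys) ≤ a + b
length-++-≤ xs xs≤a ys≤b = ≤-trans (≤-reflexive (length-++ xs)) (+-mono-≤ xs≤a ys≤b)

∈-concatMap : ∀ {A B : Set} {f : A → List B} {x xs y} → x ∈ xs → y ∈ f x → y ∈ concatMap f xs
∈-concatMap {f = f} x∈xs y∈fx = ∈-concatMap⁺ f (lose x∈xs y∈fx)

length-concatMap-≤ : ∀ {A B : Set} {f : A → List B} {n c} xs →
                     length xs ≤ n → (∀ x → length (f x) ≤ c) → length (concatMap f xs) ≤ n * c
length-concatMap-≤ {f = f} {n} {c} xs xs≤n fx≤c = ≤-trans (bound xs) (*-monoˡ-≤ c xs≤n)
  where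
  bound : ∀ xs → length (concatMap f xs) ≤ length xs * c
  bound []       = z≤n
  bound (x ∷ xs) = length-++-≤ (f x) (fx≤c x) (bound xs)

fresh : ∀ {m} (xs : List (Fin m)) → length xs < m → ∃ λ y → y ∉ xs
fresh {m} xs xs<m = Fin.¬∀⟶∃¬ m (_∈ xs) (λ y → any? (y Fin.≟_) xs) not-covering
  where
  not-covering : ¬ (∀ y → y ∈ xs)
  not-covering covers with i , j , i<j , same ← Fin.pigeonhole xs<m (index ∘ covers) =
    Fin.<⇒≢ i<j (trans (lookup-index (covers i))
                  (trans (cong (lookup xs) same) (≡-sym (lookup-index (covers j)))))

module Descent {C D : Set} (Defect : C → D → Set) (defect? : ∀ c → Decidable (Defect c))
               (ds : List D) (ds-complete : ∀ d → d ∈ ds) (Inv : C → Set) where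

  defects : C → ℕ
  defects c = length (filter (defect? c) ds)

  Repair : Set
  Repair = ∀ c → Inv c → ∀ {d} → Defect c d →
           Σ C λ c′ → Inv c′ × Defect c′ ⊆ Defect c × ¬ Defect c′ d

  repair-all : Repair → ∀ c → Inv c → Σ C λ c′ → Inv c′ × ∀ d → ¬ Defect c′ d
  repair-all repair c inv = go c inv (<-wellFounded (defects c))
    where
    go : ∀ c → Inv c → Acc _<_ (defects c) → Σ C λ c′ → Inv c′ × ∀ d → ¬ Defect c′ d
    go c inv (acc smaller) with any? (defect? c) ds
    ... | no none   = c , inv , λ d defect → none (lose (ds-complete d) defect)
    ... | yes some  =
      let d , defect = satisfied some
          c′ , inv′ , fewer , repaired = repair c inv defect
      in  go c′ inv′ (smaller (length-filter-mono-< (defect? c′) (defect? c) fewer ds (ds-complete d)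
                                                    defect repaired))

∧-not≡true : ∀ {a b} → a ∧ not b ≡ true → a ≡ true × b ≡ false
∧-not≡true {true} {false} _ = refl , refl
∧-not≡true {true} {true} ()
∧-not≡true {false} ()

∧-not≢true : ∀ {a b} → a ∧ not b ≢ true → a ≢ true ⊎ b ≡ true
∧-not≢true {false}        _  = inj₁ λ ()
∧-not≢true {true} {true}  _  = inj₂ refl
∧-not≢true {true} {false} ne = contradiction refl ne

module _ {m : ℕ} (G : SimpleGraph m) where

  neighbours : Fin m → List (Fin m)
  neighbours u = filter (λ v → T? (adj G u v)) (allFin m)

  nonNeighbours : Fin m → List (Fin m)
  nonNeighbours u = filter (∁? (λ v → T? (adj G u v))) (allFin m)

  edge? : ∀ u v → Dec (Edge G u v)
  edge? u v = adj G u v ≟ᵇ true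

  Edge-irrefl : ∀ {v} → ¬ Edge G v v
  Edge-irrefl {v} e = contradiction (trans (≡-sym e) (irrefl G v)) λ ()

  Edge⇒≢ : ∀ {u v} → Edge G u v → u ≢ v
  Edge⇒≢ e refl = Edge-irrefl e

  Edge-sym : ∀ {u v} → Edge G u v → Edge G v u
  Edge-sym {u} {v} e = trans (adj-sym G v u) e

  ∈-neighbours : ∀ {u v} → Edge G u v → v ∈ neighbours u
  ∈-neighbours {u} {v} e = ∈-filter⁺ (λ w → T? (adj G u w)) (∈-allFin v) (Equivalence.from T-≡ e)

  ∈-nonNeighbours : ∀ {u v} → ¬ Edge G u v → v ∈ nonNeighbours u
  ∈-nonNeighbours {u} {v} ¬e =
    ∈-filter⁺ (∁? (λ w → T? (adj G u w))) (∈-allFin v) (¬e ∘ Equivalence.to T-≡)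

  degree≤maxDegree : ∀ u → degree G u ≤ maxDegree G
  degree≤maxDegree u = ≤-foldr-⊔ (allFin m) (∈-allFin u)
    where
    ≤-foldr-⊔ : ∀ xs {x} → x ∈ xs → degree G x ≤ foldr _⊔_ 0 (map (degree G) xs)
    ≤-foldr-⊔ (x ∷ xs) (here refl) = m≤m⊔n (degree G x) _
    ≤-foldr-⊔ (y ∷ xs) (there x∈xs) = ≤-trans (≤-foldr-⊔ xs x∈xs) (m≤n⊔m (degree G y) _)

  minDegree≤degree : ∀ u → minDegree G ≤ degree G u
  minDegree≤degree u = foldr-⊓-≤ (allFin m) (∈-allFin u)
    where
    foldr-⊓-≤ : ∀ xs {x} → x ∈ xs → foldr _⊓_ m (map (degree G) xs) ≤ degree G x
    foldr-⊓-≤ (x ∷ xs) (here refl) = m⊓n≤m (degree G x) _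
    foldr-⊓-≤ (y ∷ xs) (there x∈xs) = ≤-trans (m⊓n≤n (degree G y) _) (foldr-⊓-≤ xs x∈xs)

  degree+length-nonNeighbours : ∀ u → degree G u + length (nonNeighbours u) ≡ m
  degree+length-nonNeighbours u =
    trans (length-filter-∁ (λ v → T? (adj G u v)) (allFin m)) (length-tabulate (λ i → i))

  length-nonNeighbours : ∀ u → length (nonNeighbours u) ≤ m ∸ minDegree G
  length-nonNeighbours u = begin
    length (nonNeighbours u)                           ≡⟨ m+n∸m≡n (degree G u) _ ⟨
    degree G u + length (nonNeighbours u) ∸ degree G u ≡⟨ cong (_∸ degree G u) (degree+length-nonNeighbours u) ⟩
    m ∸ degree G u                                     ≤⟨ ∸-monoʳ-≤ m (minDegree≤degree u) ⟩
    m ∸ minDegree G                                    ∎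
    where open ≤-Reasoning

  minDegree<order : Fin m → minDegree G < m
  minDegree<order u = begin-strict
    minDegree G                              ≤⟨ minDegree≤degree u ⟩
    degree G u                               <⟨ m<m+n (degree G u) (∈-length u∈) ⟩
    degree G u + length (nonNeighbours u)    ≡⟨ degree+length-nonNeighbours u ⟩
    m                                        ∎
    where
    open ≤-Reasoning
    u∈ : u ∈ nonNeighbours u
    u∈ = ∈-nonNeighbours Edge-irrefl

  edgeless : maxDegree G ≡ 0 → ∀ {u v} → ¬ Edge G u v
  edgeless Δ≡0 {u} e =
    n≮0 (subst (0 <_) Δ≡0 (<-≤-trans (∈-length (∈-neighbours e)) (degree≤maxDegree u)))

_∖_ : ∀ {m} → SimpleGraph m → SimpleGraph m → SimpleGraph m
adj     (G ∖ F) u v = adj G u v ∧ not (adj F u v)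
adj-sym (G ∖ F) u v = cong₂ (λ g f → g ∧ not f) (adj-sym G u v) (adj-sym F u v)
irrefl  (G ∖ F) v   = cong (_∧ not (adj F v v)) (irrefl G v)

module _ {m : ℕ} (G F : SimpleGraph m) {u v : Fin m} where

  Edge-∖⇒Edge : Edge (G ∖ F) u v → Edge G u v
  Edge-∖⇒Edge = proj₁ ∘ ∧-not≡true

  Edge⇒¬Edge-∖ : Edge F u v → ¬ Edge (G ∖ F) u v
  Edge⇒¬Edge-∖ f e = contradiction (trans (≡-sym f) (proj₂ (∧-not≡true e))) λ ()

  ¬Edge-∖⇒¬Edge⊎Edge : ¬ Edge (G ∖ F) u v → ¬ Edge G u v ⊎ Edge F u v
  ¬Edge-∖⇒¬Edge⊎Edge = ∧-not≢true

-- Covers may overlap, so that the bound for G ∖ F is simply B + Δ(F).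
record NonNeighbourCover {m} (H : SimpleGraph m) (B : ℕ) : Set where
  field
    cover    : Fin m → List (Fin m)
    complete : ∀ {u v} → ¬ Edge H u v → v ∈ cover u
    bounded  : ∀ u → length (cover u) ≤ B

open NonNeighbourCover

nonNeighbourCover : ∀ {m} (G : SimpleGraph m) → NonNeighbourCover G (m ∸ minDegree G)
cover    (nonNeighbourCover G) = nonNeighbours G
complete (nonNeighbourCover G) = ∈-nonNeighbours G
bounded  (nonNeighbourCover G) = length-nonNeighbours G

∖-nonNeighbourCover : ∀ {m} {G : SimpleGraph m} {B} → NonNeighbourCover G B →
                      (F : SimpleGraph m) → NonNeighbourCover (G ∖ F) (B + maxDegree F)
cover    (∖-nonNeighbourCover c F) u = cover c u ++ neighbours F u
complete (∖-nonNeighbourCover {G = G} c F) ¬e with ¬Edge-∖⇒¬Edge⊎Edge G F ¬e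
... | inj₁ ¬g = ∈-++⁺ˡ (complete c ¬g)
... | inj₂ f  = ∈-++⁺ʳ _ (∈-neighbours F f)
bounded  (∖-nonNeighbourCover c F) u = length-++-≤ (cover c u) (bounded c u) (degree≤maxDegree F u)

module _ {n : ℕ} where

  transpose-matchˡ : ∀ (i j : Fin n) → transpose i j i ≡ j
  transpose-matchˡ i j rewrite dec-true (i Fin.≟ i) refl = refl

  transpose-matchʳ : ∀ (i j : Fin n) → transpose i j j ≡ i
  transpose-matchʳ i j with j Fin.≟ i
  ... | yes j≡i = j≡i
  ... | no _ rewrite dec-true (j Fin.≟ j) refl = refl

  transpose-fixed : ∀ {i j k : Fin n} → k ≢ i → k ≢ j → transpose i j k ≡ k
  transpose-fixed {i} {j} {k} k≢i k≢j
    rewrite dec-false (k Fin.≟ i) k≢i | dec-false (k Fin.≟ j) k≢j = refl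

  transpose-injective : ∀ (i j : Fin n) {u v} → transpose i j u ≡ transpose i j v → u ≡ v
  transpose-injective i j {u} {v} eq = begin
    u                               ≡⟨ transpose-inverse j i ⟨
    transpose j i (transpose i j u) ≡⟨ cong (transpose j i) eq ⟩
    transpose j i (transpose i j v) ≡⟨ transpose-inverse j i ⟩
    v                               ∎
    where open ≡-Reasoning

cliqueForbiddenSize : ℕ → ℕ → ℕ
cliqueForbiddenSize ℓ′ B = 1 + (ℓ′ * B + B * suc ℓ′)

bagForbiddenSize : ℕ → ℕ → ℕ → ℕ
bagForbiddenSize ℓ′ Δa Δb = ℓ′ * (Δb * (suc ℓ′ * Δa)) + Δa * (suc ℓ′ * Δb * suc ℓ′)

module Blocks {m : ℕ} (k ℓ′ : ℕ) where

  ℓ : ℕ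
  ℓ = suc ℓ′

  Config : Set
  Config = Fin k → Fin ℓ → Fin m

  Disjoint : Config → Set
  Disjoint A = ∀ i j a b → A i a ≡ A j b → i ≡ j × a ≡ b

  CliqueBlocks : SimpleGraph m → Config → Set
  CliqueBlocks H A = ∀ i → IsClique H (A i)

  disjointConfig : k * ℓ ≤ m → Σ Config Disjoint
  disjointConfig kℓ≤m = A , disjoint
    where
    A : Config
    A i a = inject≤ (combine i a) kℓ≤m
    disjoint : Disjoint A
    disjoint i j a b eq = Fin.combine-injective i a j b (Fin.inject≤-injective kℓ≤m kℓ≤m _ _ eq)

  unique-position : ∀ {A} → Disjoint A → ∀ {i j a b v} → A i a ≡ v → A j b ≡ v → i ≡ j × a ≡ b
  unique-position disjoint {i} {j} {a} {b} ia≡v jb≡v = disjoint i j a b (trans ia≡v (≡-sym jb≡v))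

  others : Fin ℓ → List (Fin ℓ)
  others a = tabulate (punchIn a)

  ∈-others : ∀ {a b} → b ≢ a → b ∈ others a
  ∈-others b≢a = subst (_∈ others _) (Fin.punchIn-punchOut (≢-sym b≢a)) (∈-tabulate⁺ _)

  length-others : ∀ a → length (others a) ≤ ℓ′
  length-others a = ≤-reflexive (length-tabulate (punchIn a))

  position? : (A : Config) (z : Fin m) → Dec (∃ λ i → ∃ λ a → A i a ≡ z)
  position? A z = Fin.any? λ i → Fin.any? λ a → A i a Fin.≟ z

  classmates : Config → Fin m → List (Fin m)
  classmates A z with position? A z
  ... | yes (i , _) = tabulate (A i)
  ... | no _        = []

  length-classmates : ∀ A z → length (classmates A z) ≤ ℓ
  length-classmates A z with position? A z
  ... | yes (i , _) = ≤-reflexive (length-tabulate (A i))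
  ... | no _        = z≤n

  ∈-classmates : ∀ {A} → Disjoint A → ∀ {j b z} → A j b ≡ z → ∀ c → A j c ∈ classmates A z
  ∈-classmates {A} disjoint {j} {b} {z} jb≡z c with position? A z
  ... | no none = contradiction (j , b , jb≡z) none
  ... | yes (i , a , ia≡z) with refl , _ ← unique-position disjoint ia≡z jb≡z = ∈-tabulate⁺ {f = A i} c

  blockNeighbours : SimpleGraph m → Config → Fin m → List (Fin m)
  blockNeighbours G A z = concatMap (neighbours G) (classmates A z)

  length-blockNeighbours : ∀ G A z → length (blockNeighbours G A z) ≤ ℓ * maxDegree G
  length-blockNeighbours G A z =
    length-concatMap-≤ (classmates A z) (length-classmates A z) (degree≤maxDegree G)

  swap : Config → Fin m → Fin m → Config
  swap A x y i a = transpose x y (A i a)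

  swap-disjoint : ∀ {A} → Disjoint A → ∀ x y → Disjoint (swap A x y)
  swap-disjoint disjoint x y i j a b eq = disjoint i j a b (transpose-injective x y eq)

  -- y may take the place of x = A i₀ a₀ in block i₀, and x the place of y in y's block (if any).
  record Admissible (H : SimpleGraph m) (A : Config) (i₀ : Fin k) (a₀ : Fin ℓ) (y : Fin m) : Set where
    field
      y≢x        : y ≢ A i₀ a₀
      y-adjacent : ∀ b → b ≢ a₀ → Edge H (A i₀ b) y
      x-adjacent : ∀ j b c → A j c ≡ y → Edge H (A i₀ a₀) (A j b)

  BagIndex : Set
  BagIndex = Fin k × Fin k × Fin ℓ × Fin ℓ × Fin ℓ × Fin ℓ

  -- As blocks are disjoint, vertex-disjointness of the two edges of a bag means a ≢ c and b ≢ d.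
  OrientedBag : SimpleGraph m → SimpleGraph m → Config → BagIndex → Set
  OrientedBag Ga Gb A (i , j , a , b , c , d) =
    i ≢ j × a ≢ c × b ≢ d × Edge Ga (A i a) (A j b) × Edge Gb (A i c) (A j d)

  AltBag⇒OrientedBag : ∀ Ga Gb {A i j} → i ≢ j → AltBag Ga Gb (A i) (A j) → ∃ (OrientedBag Ga Gb A)
  AltBag⇒OrientedBag _ _ {A} {i} {j} i≢j (a , b , c , d , ea , eb , ia≢ic , _ , _ , jb≢jd) =
    (i , j , a , b , c , d) , i≢j , ia≢ic ∘ cong (A i) , jb≢jd ∘ cong (A j) , ea , eb

  module _ (Ga Gb : SimpleGraph m) {A : Config} {i j : Fin k} {a b c d : Fin ℓ} where

    OrientedBag-swapColours : OrientedBag Ga Gb A (i , j , a , b , c , d) →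
                              OrientedBag Gb Ga A (i , j , c , d , a , b)
    OrientedBag-swapColours (i≢j , a≢c , b≢d , ea , eb) = i≢j , ≢-sym a≢c , ≢-sym b≢d , eb , ea

    OrientedBag-swapBlocks : OrientedBag Ga Gb A (i , j , a , b , c , d) →
                             OrientedBag Ga Gb A (j , i , b , a , d , c)
    OrientedBag-swapBlocks (i≢j , a≢c , b≢d , ea , eb) =
      ≢-sym i≢j , b≢d , a≢c , Edge-sym Ga ea , Edge-sym Gb eb

  -- After swapping x = A i₀ a₀ and y, no (Ga, Gb)-bag uses y in block i₀ together with another
  -- vertex of block i₀ (y-side), nor x in the former block of y (x-side).
  record BagAdmissible (Ga Gb : SimpleGraph m) (A : Config) (i₀ : Fin k) (a₀ : Fin ℓ) (y : Fin m) : Set where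
    field
      y-side : ∀ c → c ≢ a₀ → ∀ j b d → Edge Gb (A i₀ c) (A j d) → ¬ Edge Ga (A j b) y
      x-side : ∀ j b d i c a → Edge Ga (A i₀ a₀) (A j b) → Edge Gb (A j d) (A i c) → A i a ≢ y

  module Swapped (H : SimpleGraph m) {A : Config} (disjoint : Disjoint A)
                 {i₀ : Fin k} {a₀ : Fin ℓ} {y : Fin m} (adm : Admissible H A i₀ a₀ y) where
    open Admissible adm

    x : Fin m
    x = A i₀ a₀

    A′ : Config
    A′ = swap A x y

    Moved : Fin m → Set
    Moved v = v ≡ x ⊎ v ≡ y

    moved? : ∀ v → Dec (Moved v)
    moved? v = (v Fin.≟ x) ⊎-dec (v Fin.≟ y)

    swap-x : ∀ {i a} → A i a ≡ x → A′ i a ≡ y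
    swap-x ia≡x = trans (cong (transpose x y) ia≡x) (transpose-matchˡ x y)

    swap-y : ∀ {i a} → A i a ≡ y → A′ i a ≡ x
    swap-y ia≡y = trans (cong (transpose x y) ia≡y) (transpose-matchʳ x y)

    swap-fixed : ∀ {i a} → ¬ Moved (A i a) → A′ i a ≡ A i a
    swap-fixed unmoved = transpose-fixed (unmoved ∘ inj₁) (unmoved ∘ inj₂)

    x-position : ∀ {i a} → A i a ≡ x → i ≡ i₀ × a ≡ a₀
    x-position {i} {a} = disjoint i i₀ a a₀

    y∉block₀ : ∀ b → A i₀ b ≢ y
    y∉block₀ b i₀b≡y with b Fin.≟ a₀
    ... | yes refl = y≢x (≡-sym i₀b≡y)
    ... | no b≢a₀  = Edge⇒≢ H (y-adjacent b b≢a₀) i₀b≡y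

    unmoved-block₀ : ∀ {b} → b ≢ a₀ → ¬ Moved (A i₀ b)
    unmoved-block₀ b≢a₀ (inj₁ b≡x) = b≢a₀ (proj₂ (x-position b≡x))
    unmoved-block₀ {b} _ (inj₂ b≡y) = y∉block₀ b b≡y

    unmoved-block-of-y : ∀ {i a b} → A i a ≡ y → a ≢ b → ¬ Moved (A i b)
    unmoved-block-of-y {a = a} ia≡y _ (inj₁ ib≡x) with refl , _ ← x-position ib≡x = y∉block₀ a ia≡y
    unmoved-block-of-y ia≡y a≢b (inj₂ ib≡y) = a≢b (proj₂ (unique-position disjoint ia≡y ib≡y))

    unmoved-outside-block₀ : ∀ {j e} → j ≢ i₀ → A j e ≢ y → ¬ Moved (A j e)
    unmoved-outside-block₀ j≢i₀ _    (inj₁ je≡x) = j≢i₀ (proj₁ (x-position je≡x))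
    unmoved-outside-block₀ _    je≢y (inj₂ je≡y) = je≢y je≡y

    unmoved-outside-block-of-y : ∀ {i a j e} → A i a ≡ y → i ≢ j → A j e ≢ x → ¬ Moved (A j e)
    unmoved-outside-block-of-y _    _   je≢x (inj₁ je≡x) = je≢x je≡x
    unmoved-outside-block-of-y ia≡y i≢j _    (inj₂ je≡y) = i≢j (proj₁ (unique-position disjoint ia≡y je≡y))

    moved-edge : ∀ {i a b} → a ≢ b → Moved (A i a) → Edge H (A′ i a) (A′ i b)
    moved-edge {b = b} a≢b (inj₁ ia≡x) with refl , refl ← x-position ia≡x =
      subst₂ (Edge H) (≡-sym (swap-x ia≡x)) (≡-sym (swap-fixed (unmoved-block₀ (≢-sym a≢b))))
        (Edge-sym H (y-adjacent b (≢-sym a≢b)))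
    moved-edge {i} {a} {b} a≢b (inj₂ ia≡y) =
      subst₂ (Edge H) (≡-sym (swap-y ia≡y)) (≡-sym (swap-fixed (unmoved-block-of-y ia≡y a≢b)))
        (x-adjacent i b a ia≡y)

    swap-edge : ∀ {i a b} → a ≢ b → Edge H (A i a) (A i b) → Edge H (A′ i a) (A′ i b)
    swap-edge {i} {a} {b} a≢b e with moved? (A i a) | moved? (A i b)
    ... | yes a-moved | _           = moved-edge a≢b a-moved
    ... | no _        | yes b-moved = Edge-sym H (moved-edge (≢-sym a≢b) b-moved)
    ... | no a-fixed  | no b-fixed  =
      subst₂ (Edge H) (≡-sym (swap-fixed a-fixed)) (≡-sym (swap-fixed b-fixed)) e

    swap-cliqueBlocks : CliqueBlocks H A → CliqueBlocks H A′
    swap-cliqueBlocks cliques i a b a≢b = swap-edge a≢b (cliques i a b a≢b)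

    unmoved-bag : ∀ Ga Gb {i j a b c d} →
                  ¬ Moved (A i a) → ¬ Moved (A j b) → ¬ Moved (A i c) → ¬ Moved (A j d) →
                  OrientedBag Ga Gb A′ (i , j , a , b , c , d) → OrientedBag Ga Gb A (i , j , a , b , c , d)
    unmoved-bag Ga Gb ia jb ic jd (i≢j , a≢c , b≢d , ea , eb) =
      i≢j , a≢c , b≢d , subst₂ (Edge Ga) (swap-fixed ia) (swap-fixed jb) ea
                      , subst₂ (Edge Gb) (swap-fixed ic) (swap-fixed jd) eb

    module NoNewBags (cliques : CliqueBlocks H A) (Ga Gb : SimpleGraph m)
                     (Ga⊥H : ∀ {u v} → Edge Ga u v → ¬ Edge H u v)
                     (bag-adm : BagAdmissible Ga Gb A i₀ a₀ y) where
      open BagAdmissible bag-adm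

      no-bag-at-x : ∀ {j b c d} → ¬ OrientedBag Ga Gb A′ (i₀ , j , a₀ , b , c , d)
      no-bag-at-x {j} {b} {c} {d} (i₀≢j , a₀≢c , b≢d , ea , eb) =
        cases (A j b Fin.≟ y) (A j d Fin.≟ y)
        where
        unmoved : ∀ {e} → A j e ≢ y → ¬ Moved (A j e)
        unmoved = unmoved-outside-block₀ (≢-sym i₀≢j)

        cases : Dec (A j b ≡ y) → Dec (A j d ≡ y) → ⊥
        cases (yes jb≡y) _ =
          Ga⊥H (subst₂ (Edge Ga) (swap-x refl) (swap-y jb≡y) ea)
               (Edge-sym H (subst (Edge H x) jb≡y (x-adjacent j b b jb≡y)))
        cases (no jb≢y) (yes jd≡y) =
          Ga⊥H (subst₂ (Edge Ga) (swap-x refl) (swap-fixed (unmoved jb≢y)) ea)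
               (subst (λ v → Edge H v (A j b)) jd≡y (cliques j d b (≢-sym b≢d)))
        cases (no jb≢y) (no jd≢y) =
          y-side c (≢-sym a₀≢c) j b d
            (subst₂ (Edge Gb) (swap-fixed (unmoved-block₀ (≢-sym a₀≢c))) (swap-fixed (unmoved jd≢y)) eb)
            (Edge-sym Ga (subst₂ (Edge Ga) (swap-x refl) (swap-fixed (unmoved jb≢y)) ea))

      no-bag-at-y : ∀ {i j a b c d} → A i a ≡ y → ¬ OrientedBag Ga Gb A′ (i , j , a , b , c , d)
      no-bag-at-y {i} {j} {a} {b} {c} {d} ia≡y (i≢j , a≢c , b≢d , ea , eb) =
        cases (A j b Fin.≟ x) (A j d Fin.≟ x)
        where
        unmoved : ∀ {e} → A j e ≢ x → ¬ Moved (A j e)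
        unmoved = unmoved-outside-block-of-y ia≡y i≢j

        cases : Dec (A j b ≡ x) → Dec (A j d ≡ x) → ⊥
        cases (yes jb≡x) _ =
          Ga⊥H (subst₂ (Edge Ga) (swap-y ia≡y) (swap-x jb≡x) ea)
               (subst (Edge H x) ia≡y (x-adjacent i a a ia≡y))
        cases (no jb≢x) (yes jd≡x) =
          Ga⊥H (subst₂ (Edge Ga) (swap-y ia≡y) (swap-fixed (unmoved jb≢x)) ea)
               (subst (λ v → Edge H v (A j b)) jd≡x (cliques j d b (≢-sym b≢d)))
        cases (no jb≢x) (no jd≢x) =
          x-side j b d i c a
            (subst₂ (Edge Ga) (swap-y ia≡y) (swap-fixed (unmoved jb≢x)) ea)
            (Edge-sym Gb (subst₂ (Edge Gb) (swap-fixed (unmoved-block-of-y ia≡y a≢c))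
                                          (swap-fixed (unmoved jd≢x)) eb))
            ia≡y

      no-moved-bag : ∀ {i j a b c d} → Moved (A i a) → ¬ OrientedBag Ga Gb A′ (i , j , a , b , c , d)
      no-moved-bag (inj₁ ia≡x) bag with refl , refl ← x-position ia≡x = no-bag-at-x bag
      no-moved-bag (inj₂ ia≡y) bag = no-bag-at-y ia≡y bag

  module Forbidden (H : SimpleGraph m) {B : ℕ} (cov : NonNeighbourCover H B) where

    forbidden : Config → Fin k → Fin ℓ → List (Fin m)
    forbidden A i₀ a₀ =
      A i₀ a₀ ∷ (concatMap (cover cov ∘ A i₀) (others a₀) ++ concatMap (classmates A) (cover cov (A i₀ a₀)))

    length-forbidden : ∀ A i₀ a₀ → length (forbidden A i₀ a₀) ≤ cliqueForbiddenSize ℓ′ B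
    length-forbidden A i₀ a₀ = s≤s (length-++-≤ (concatMap (cover cov ∘ A i₀) (others a₀))
      (length-concatMap-≤ (others a₀) (length-others a₀) (bounded cov ∘ A i₀))
      (length-concatMap-≤ (cover cov (A i₀ a₀)) (bounded cov (A i₀ a₀)) (length-classmates A)))

    admissible : ∀ {A} → Disjoint A → ∀ {i₀ a₀ y} → y ∉ forbidden A i₀ a₀ → Admissible H A i₀ a₀ y
    Admissible.y≢x (admissible _ y∉) y≡x = y∉ (here y≡x)
    Admissible.y-adjacent (admissible {A} _ {i₀} {a₀} {y} y∉) b b≢a₀ =
      decidable-stable (edge? H (A i₀ b) y) λ ¬e →
        y∉ (there (∈-++⁺ˡ (∈-concatMap (∈-others b≢a₀) (complete cov ¬e))))
    Admissible.x-adjacent (admissible {A} disjoint {i₀} {a₀} {y} y∉) j b c jc≡y =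
      decidable-stable (edge? H (A i₀ a₀) (A j b)) λ ¬e →
        y∉ (there (∈-++⁺ʳ _ (∈-concatMap (complete cov ¬e)
                              (subst (_∈ _) jc≡y (∈-classmates disjoint refl c)))))

  bagForbidden : SimpleGraph m → SimpleGraph m → Config → Fin k → Fin ℓ → List (Fin m)
  bagForbidden Ga Gb A i₀ a₀ =
    concatMap (concatMap (blockNeighbours Ga A) ∘ neighbours Gb ∘ A i₀) (others a₀) ++
    concatMap (concatMap (classmates A) ∘ blockNeighbours Gb A) (neighbours Ga (A i₀ a₀))

  length-bagForbidden : ∀ Ga Gb A i₀ a₀ →
                        length (bagForbidden Ga Gb A i₀ a₀) ≤ bagForbiddenSize ℓ′ (maxDegree Ga) (maxDegree Gb)
  length-bagForbidden Ga Gb A i₀ a₀ =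
    length-++-≤ (concatMap (concatMap (blockNeighbours Ga A) ∘ neighbours Gb ∘ A i₀) (others a₀))
      (length-concatMap-≤ (others a₀) (length-others a₀) λ c →
        length-concatMap-≤ (neighbours Gb (A i₀ c)) (degree≤maxDegree Gb (A i₀ c)) (length-blockNeighbours Ga A))
      (length-concatMap-≤ (neighbours Ga (A i₀ a₀)) (degree≤maxDegree Ga (A i₀ a₀)) λ z →
        length-concatMap-≤ (blockNeighbours Gb A z) (length-blockNeighbours Gb A z) (length-classmates A))

  bagAdmissible : ∀ {Ga Gb A} → Disjoint A → ∀ {i₀ a₀ y} → y ∉ bagForbidden Ga Gb A i₀ a₀ →
                  BagAdmissible Ga Gb A i₀ a₀ y
  BagAdmissible.y-side (bagAdmissible {Ga} {Gb} disjoint y∉) c c≢a₀ j b d eb ea =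
    y∉ (∈-++⁺ˡ (∈-concatMap (∈-others c≢a₀) (∈-concatMap (∈-neighbours Gb eb)
          (∈-concatMap (∈-classmates disjoint refl b) (∈-neighbours Ga ea)))))
  BagAdmissible.x-side (bagAdmissible {Ga} {Gb} disjoint y∉) j b d i c a ea eb ia≡y =
    y∉ (∈-++⁺ʳ _ (∈-concatMap (∈-neighbours Ga ea)
          (∈-concatMap (∈-concatMap (∈-classmates disjoint refl d) (∈-neighbours Gb eb))
            (subst (_∈ _) ia≡y (∈-classmates disjoint refl a)))))

  PairIndex : Set
  PairIndex = Fin k × Fin ℓ × Fin ℓ

  allPairIndices : List PairIndex
  allPairIndices = cartesianProduct (allFin k) (cartesianProduct (allFin ℓ) (allFin ℓ))

  ∈-allPairIndices : ∀ t → t ∈ allPairIndices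
  ∈-allPairIndices (i , a , b) =
    ∈-cartesianProduct⁺ (∈-allFin i) (∈-cartesianProduct⁺ (∈-allFin a) (∈-allFin b))

  allBagIndices : List BagIndex
  allBagIndices = cartesianProduct (allFin k) (cartesianProduct (allFin k) (cartesianProduct (allFin ℓ)
                    (cartesianProduct (allFin ℓ) (cartesianProduct (allFin ℓ) (allFin ℓ)))))

  ∈-allBagIndices : ∀ t → t ∈ allBagIndices
  ∈-allBagIndices (i , j , a , b , c , d) =
    ∈-cartesianProduct⁺ (∈-allFin i) (∈-cartesianProduct⁺ (∈-allFin j) (∈-cartesianProduct⁺ (∈-allFin a)
      (∈-cartesianProduct⁺ (∈-allFin b) (∈-cartesianProduct⁺ (∈-allFin c) (∈-allFin d)))))

  MissingEdge : SimpleGraph m → Config → PairIndex → Set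
  MissingEdge H A (i , a , b) = a ≢ b × ¬ Edge H (A i a) (A i b)

  missingEdge? : ∀ H A → Decidable (MissingEdge H A)
  missingEdge? H A (i , a , b) = ¬? (a Fin.≟ b) ×-dec ¬? (edge? H (A i a) (A i b))

  orientedBag? : ∀ Ga Gb A → Decidable (OrientedBag Ga Gb A)
  orientedBag? Ga Gb A (i , j , a , b , c , d) =
    ¬? (i Fin.≟ j) ×-dec ¬? (a Fin.≟ c) ×-dec ¬? (b Fin.≟ d) ×-dec
    edge? Ga (A i a) (A j b) ×-dec edge? Gb (A i c) (A j d)

  cliqueBlocks : ∀ (H : SimpleGraph m) {B} → NonNeighbourCover H B → k * ℓ ≤ m →
                 cliqueForbiddenSize ℓ′ B < m → Σ Config λ A → Disjoint A × CliqueBlocks H A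
  cliqueBlocks H cov kℓ≤m room =
    let A₀ , disjoint₀ = disjointConfig kℓ≤m
        A , disjoint , no-missing-edge = repair-all repair A₀ disjoint₀
    in  A , disjoint , λ i a b a≢b →
          decidable-stable (edge? H (A i a) (A i b)) (no-missing-edge (i , a , b) ∘ (a≢b ,_))
    where
    open Descent (MissingEdge H) (missingEdge? H) allPairIndices ∈-allPairIndices Disjoint
    open Forbidden H cov

    swap-repair : ∀ {A} → Disjoint A → ∀ {i₀ a₀ b₀ y} → a₀ ≢ b₀ → y ∉ forbidden A i₀ a₀ →
                  Σ Config λ A′ → Disjoint A′ × MissingEdge H A′ ⊆ MissingEdge H A ×
                                  ¬ MissingEdge H A′ (i₀ , a₀ , b₀)
    swap-repair {A} disjoint {y = y} a₀≢b₀ y∉ =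
      A′ , swap-disjoint disjoint x y , fewer , λ (_ , ¬e) → ¬e (moved-edge a₀≢b₀ (inj₁ refl))
      where
      open Swapped H disjoint (admissible disjoint y∉)
      fewer : MissingEdge H A′ ⊆ MissingEdge H A
      fewer {_ , a , b} (a≢b , ¬e) = a≢b , ¬e ∘ swap-edge a≢b

    repair : Repair
    repair A disjoint {i₀ , a₀ , b₀} (a₀≢b₀ , _) =
      let y , y∉ = fresh (forbidden A i₀ a₀) (≤-<-trans (length-forbidden A i₀ a₀) room)
      in  swap-repair disjoint a₀≢b₀ y∉

  bagFreeCliqueBlocks :
    ∀ (H : SimpleGraph m) {B} → NonNeighbourCover H B → ∀ G₂ G₃ →
    (∀ {u v} → Edge G₂ u v → ¬ Edge H u v) → (∀ {u v} → Edge G₃ u v → ¬ Edge H u v) →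
    cliqueForbiddenSize ℓ′ B + (bagForbiddenSize ℓ′ (maxDegree G₂) (maxDegree G₃) +
                                bagForbiddenSize ℓ′ (maxDegree G₃) (maxDegree G₂)) < m →
    ∀ A → Disjoint A → CliqueBlocks H A →
    Σ Config λ A′ → Disjoint A′ × CliqueBlocks H A′ × ∀ t → ¬ OrientedBag G₂ G₃ A′ t
  bagFreeCliqueBlocks H cov G₂ G₃ G₂⊥H G₃⊥H room A₀ disjoint₀ cliques₀ =
    let A , (disjoint , cliques) , bag-free = repair-all repair A₀ (disjoint₀ , cliques₀)
    in  A , disjoint , cliques , bag-free
    where
    Invariant : Config → Set
    Invariant A = Disjoint A × CliqueBlocks H A

    open Descent (OrientedBag G₂ G₃) (orientedBag? G₂ G₃) allBagIndices ∈-allBagIndices Invariant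
    open Forbidden H cov

    allForbidden : Config → Fin k → Fin ℓ → List (Fin m)
    allForbidden A i₀ a₀ =
      forbidden A i₀ a₀ ++ (bagForbidden G₂ G₃ A i₀ a₀ ++ bagForbidden G₃ G₂ A i₀ a₀)

    length-allForbidden : ∀ A i₀ a₀ → length (allForbidden A i₀ a₀) < m
    length-allForbidden A i₀ a₀ = ≤-<-trans
      (length-++-≤ (forbidden A i₀ a₀) (length-forbidden A i₀ a₀)
        (length-++-≤ (bagForbidden G₂ G₃ A i₀ a₀) (length-bagForbidden G₂ G₃ A i₀ a₀)
                                                  (length-bagForbidden G₃ G₂ A i₀ a₀)))
      room

    swap-repair : ∀ {A} → Invariant A → ∀ {i₀ a₀ y} → y ∉ allForbidden A i₀ a₀ →
                  Σ Config λ A′ → Invariant A′ × OrientedBag G₂ G₃ A′ ⊆ OrientedBag G₂ G₃ A ×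
                                  ∀ {j b c d} → ¬ OrientedBag G₂ G₃ A′ (i₀ , j , a₀ , b , c , d)
    swap-repair {A} (disjoint , cliques) {i₀} {a₀} {y} y∉ =
      A′ , (swap-disjoint disjoint x y , swap-cliqueBlocks cliques) , fewer , N₂₃.no-moved-bag (inj₁ refl)
      where
      y∉forbidden : y ∉ forbidden A i₀ a₀
      y∉forbidden = y∉ ∘ ∈-++⁺ˡ

      y∉bagForbidden₂₃ : y ∉ bagForbidden G₂ G₃ A i₀ a₀
      y∉bagForbidden₂₃ = y∉ ∘ ∈-++⁺ʳ (forbidden A i₀ a₀) ∘ ∈-++⁺ˡ

      y∉bagForbidden₃₂ : y ∉ bagForbidden G₃ G₂ A i₀ a₀
      y∉bagForbidden₃₂ = y∉ ∘ ∈-++⁺ʳ (forbidden A i₀ a₀) ∘ ∈-++⁺ʳ (bagForbidden G₂ G₃ A i₀ a₀)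

      open Swapped H disjoint (admissible disjoint y∉forbidden)
      module N₂₃ = NoNewBags cliques G₂ G₃ G₂⊥H (bagAdmissible disjoint y∉bagForbidden₂₃)
      module N₃₂ = NoNewBags cliques G₃ G₂ G₃⊥H (bagAdmissible disjoint y∉bagForbidden₃₂)

      fewer : OrientedBag G₂ G₃ A′ ⊆ OrientedBag G₂ G₃ A
      fewer {i , j , a , b , c , d} bag with moved? (A i a) | moved? (A i c) | moved? (A j b) | moved? (A j d)
      ... | yes ia | _     | _     | _     = ⊥-elim (N₂₃.no-moved-bag ia bag)
      ... | no _   | yes ic | _     | _     = ⊥-elim (N₃₂.no-moved-bag ic (OrientedBag-swapColours G₂ G₃ bag))
      ... | no _   | no _  | yes jb | _     = ⊥-elim (N₂₃.no-moved-bag jb (OrientedBag-swapBlocks G₂ G₃ bag))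
      ... | no _   | no _  | no _  | yes jd =
        ⊥-elim (N₃₂.no-moved-bag jd (OrientedBag-swapColours G₂ G₃ (OrientedBag-swapBlocks G₂ G₃ bag)))
      ... | no ia  | no ic | no jb | no jd  = unmoved-bag G₂ G₃ ia jb ic jd bag

    repair : Repair
    repair A inv {i₀ , _ , a₀ , _} _ =
      let y , y∉ = fresh (allForbidden A i₀ a₀) (length-allForbidden A i₀ a₀)
          A′ , inv′ , fewer , no-bag-at-y = swap-repair inv y∉
      in  A′ , inv′ , fewer , no-bag-at-y

≤-complement : ∀ q {m δ} → δ ≤ m → m * q ≤ suc q * δ → suc q * (m ∸ δ) ≤ m
≤-complement q {m} {δ} δ≤m mq≤ = begin
  suc q * (m ∸ δ)     ≡⟨⟩
  m ∸ δ + q * (m ∸ δ) ≤⟨ +-monoʳ-≤ (m ∸ δ) q[m∸δ]≤δ ⟩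
  m ∸ δ + δ           ≡⟨ m∸n+n≡m δ≤m ⟩
  m                   ∎
  where
  open ≤-Reasoning
  q[m∸δ]≤δ : q * (m ∸ δ) ≤ δ
  q[m∸δ]≤δ = +-cancelˡ-≤ (q * δ) _ _ (begin
    q * δ + q * (m ∸ δ) ≡⟨ *-distribˡ-+ q δ (m ∸ δ) ⟨
    q * (δ + (m ∸ δ))   ≡⟨ cong (q *_) (m+[n∸m]≡n δ≤m) ⟩
    q * m               ≡⟨ *-comm q m ⟩
    m * q               ≤⟨ mq≤ ⟩
    suc q * δ           ≡⟨ +-comm δ (q * δ) ⟩
    q * δ + δ           ∎)

cliqueForbiddenSize-< : ∀ p {N m} → 1 ≤ N → 3 * (2 + p) * N ≤ m → cliqueForbiddenSize (suc p) N < m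
cliqueForbiddenSize-< p {suc n} _ 3ℓN≤m =
  ≤-trans (m≤m+n _ _) (≤-trans (≤-reflexive (identity p n)) 3ℓN≤m)
  where
  identity : ∀ p n → suc (1 + (suc p * suc n + suc n * suc (suc p))) + ((3 + p) * n + (1 + p))
                     ≡ 3 * (2 + p) * suc n
  identity = solve-∀

-- Writing Δ₂ = 1 + a and Δ₃ = 1 + b, three times (bound + 1), plus 3 N and a polynomial in p, a, b
-- with nonnegative coefficients, is exactly twice the left side of the first hypothesis plus that
-- of the second.
bagForbiddenSize-< : ∀ p {N Δ₂ Δ₃ m} → 1 ≤ Δ₂ → 1 ≤ Δ₃ →
                     3 * (2 + p) * N ≤ m → 15 * ((2 + p) * (2 + p)) * (Δ₂ * Δ₃) + 3 ≤ m →
                     cliqueForbiddenSize (suc p) (N + Δ₂ + Δ₃) +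
                       (bagForbiddenSize (suc p) Δ₂ Δ₃ + bagForbiddenSize (suc p) Δ₃ Δ₂) < m
bagForbiddenSize-< p {N} {suc a} {suc b} {m} _ _ 3ℓN≤m 15ℓ²Δ₂Δ₃+3≤m = *-cancelˡ-≤ 3
  (≤-trans (m≤m+n _ _)
    (≤-trans (≤-reflexive (identity p N a b))
      (≤-trans (+-mono-≤ (*-monoʳ-≤ 2 3ℓN≤m) 15ℓ²Δ₂Δ₃+3≤m) (≤-reflexive (+-comm (2 * m) m)))))
  where
  identity : ∀ p N a b →
    3 * suc ((1 + (suc p * (N + suc a + suc b) + (N + suc a + suc b) * suc (suc p)))
             + ((suc p * (suc b * (suc (suc p) * suc a)) + suc a * (suc (suc p) * suc b * suc (suc p)))
              + (suc p * (suc a * (suc (suc p) * suc b)) + suc b * (suc (suc p) * suc a * suc (suc p)))))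
    + 3 * (N + ((1 + p) * (1 + p) + (p * p + 4 * p + 5) * (a + b) + (2 + p) * (4 + p) * a * b))
    ≡ 2 * (3 * (2 + p) * N) + (15 * ((2 + p) * (2 + p)) * (suc a * suc b) + 3)
  identity = solve-∀

module CliqueFactors {m : ℕ} (p : ℕ) (G₁ : SimpleGraph m) (δ₁<m : minDegree G₁ < m)
                    (min-degree : m * (3 * (2 + p) ∸ 1) ≤ 3 * (2 + p) * minDegree G₁) where
  open Blocks {m} (m / (2 + p)) (suc p) public

  fits : m / (2 + p) * (2 + p) ≤ m
  fits = m/n*n≤m m (2 + p)

  N : ℕ
  N = m ∸ minDegree G₁

  few-non-neighbours : 3 * (2 + p) * N ≤ m
  few-non-neighbours = ≤-complement (3 * (2 + p) ∸ 1) (<⇒≤ δ₁<m) min-degree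

  cliqueFactor : Σ Config λ A → Disjoint A × CliqueBlocks G₁ A
  cliqueFactor = cliqueBlocks G₁ (nonNeighbourCover G₁) fits
                   (cliqueForbiddenSize-< p (m<n⇒0<n∸m δ₁<m) few-non-neighbours)

  module _ (G₂ G₃ : SimpleGraph m) where

    H : SimpleGraph m
    H = (G₁ ∖ G₂) ∖ G₃

    H⊆G₁ : ∀ {u v} → Edge H u v → Edge G₁ u v
    H⊆G₁ {u} {v} = Edge-∖⇒Edge G₁ G₂ {u} {v} ∘ Edge-∖⇒Edge (G₁ ∖ G₂) G₃

    G₂⊥H : ∀ {u v} → Edge G₂ u v → ¬ Edge H u v
    G₂⊥H {u} {v} e₂ = Edge⇒¬Edge-∖ G₁ G₂ {u} {v} e₂ ∘ Edge-∖⇒Edge (G₁ ∖ G₂) G₃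

    G₃⊥H : ∀ {u v} → Edge G₃ u v → ¬ Edge H u v
    G₃⊥H {u} {v} = Edge⇒¬Edge-∖ (G₁ ∖ G₂) G₃ {u} {v}

    bagFreeCliqueFactor : 1 ≤ maxDegree G₂ → 1 ≤ maxDegree G₃ →
                          15 * ((2 + p) * (2 + p)) * (maxDegree G₂ * maxDegree G₃) + 3 ≤ m →
                          Σ Config λ A → Disjoint A × CliqueBlocks G₁ A × ∀ t → ¬ OrientedBag G₂ G₃ A t
    bagFreeCliqueFactor 1≤Δ₂ 1≤Δ₃ max-degrees =
      let A₁ , disjoint₁ , cliques₁ = cliqueBlocks H cov fits (≤-<-trans (m≤m+n _ _) room)
          A , disjoint , cliques , bag-free =
            bagFreeCliqueBlocks H cov G₂ G₃ G₂⊥H G₃⊥H room A₁ disjoint₁ cliques₁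
      in  A , disjoint , (λ i a b a≢b → H⊆G₁ (cliques i a b a≢b)) , bag-free
      where
      B : ℕ
      B = N + maxDegree G₂ + maxDegree G₃

      cov : NonNeighbourCover H B
      cov = ∖-nonNeighbourCover (∖-nonNeighbourCover (nonNeighbourCover G₁) G₂) G₃

      room : cliqueForbiddenSize (suc p) B + (bagForbiddenSize (suc p) (maxDegree G₂) (maxDegree G₃) +
                                              bagForbiddenSize (suc p) (maxDegree G₃) (maxDegree G₂)) < m
      room = bagForbiddenSize-< p {N} 1≤Δ₂ 1≤Δ₃ few-non-neighbours max-degrees

theorem8 : (m ℓ : ℕ) → 2 ≤ ℓ → .{{_ : NonZero ℓ}} →
    (G₁ G₂ G₃ : SimpleGraph m) →
    m * (3 * ℓ ∸ 1) ≤ 3 * ℓ * minDegree G₁ →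
    15 * (ℓ * ℓ) * (maxDegree G₂ * maxDegree G₃) + 3 ≤ m →
    Σ (Fin (m / ℓ) → Fin ℓ → Fin m) λ A →
      (∀ i j a b → A i a ≡ A j b → (i ≡ j × a ≡ b)) ×
      (∀ i → IsClique G₁ (A i)) ×
      (∀ i j → i ≢ j → ¬ AltBag G₂ G₃ (A i) (A j))
theorem8 zero (suc (suc _)) (s≤s (s≤s z≤n)) _ _ _ _ _ = (λ ()) , (λ ()) , (λ ()) , (λ ())
theorem8 m@(suc _) (suc (suc p)) (s≤s (s≤s z≤n)) G₁ G₂ G₃ min-degree max-degrees =
  factor (maxDegree G₂ ≟ 0) (maxDegree G₃ ≟ 0)
  where
  open CliqueFactors p G₁ (minDegree<order G₁ fzero) min-degree

  Result : Set
  Result = Σ Config λ A → Disjoint A × CliqueBlocks G₁ A ×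
                           ∀ i j → i ≢ j → ¬ AltBag G₂ G₃ (A i) (A j)

  without-bags : (∀ {A₁ A₂ : Fin (2 + p) → Fin m} → ¬ AltBag G₂ G₃ A₁ A₂) → Result
  without-bags no-bag =
    let A , disjoint , cliques = cliqueFactor in A , disjoint , cliques , λ _ _ _ → no-bag

  factor : Dec (maxDegree G₂ ≡ 0) → Dec (maxDegree G₃ ≡ 0) → Result
  factor (yes Δ₂≡0) _          = without-bags λ (_ , _ , _ , _ , e₂ , _) → edgeless G₂ Δ₂≡0 e₂
  factor (no _)     (yes Δ₃≡0) = without-bags λ (_ , _ , _ , _ , _ , e₃ , _) → edgeless G₃ Δ₃≡0 e₃
  factor (no Δ₂≢0)  (no Δ₃≢0)  =
    let A , disjoint , cliques , bag-free =
          bagFreeCliqueFactor G₂ G₃ (n≢0⇒n>0 Δ₂≢0) (n≢0⇒n>0 Δ₃≢0) max-degrees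
    in  A , disjoint , cliques , λ i j i≢j → uncurry bag-free ∘ AltBag⇒OrientedBag G₂ G₃ i≢j
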